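{- Let $(G,v)$ be a Hamel space over an ordered field $C$ and $G_0\subseteq G$ a $C$-linear subspace. For any $c_1,\dots,c_m\in G\setminus G_0$, \[\#\Big(v\big(G_0+\textstyle\sum_{i=1}^mCc_i\big)\setminus v(G_0)\Big)\leq m.\] In particular, there are $n\leq m$ and distinct $d_1,\dots,d_n\in v(G_0+\sum_{i=1}^mCc_i)\setminus v(G_0)$ such that $v(G_0+\sum_{i=1}^mCc_i)\subseteq v(G_0)\cup\{d_1,\dots,d_n\}$.
   Context: A $2$-ordered $C$-vector space is a $C$-vector space $G$ with two linear orders $<_0,<_1$, each making $G$ an ordered $C$-vector space (ordered abelian group with $\lambda>0,x>0\Rightarrow\lambda x>0$ for $\lambda\in C$). Put $G_\infty=G\cup\{\infty\}$ with $\infty$ above $G$ in both orders. A Hamel valuation on $G$ is a map $v:G\to G_\infty$ such that for all $x,y\in G$, $\lambda\in C\setminus\{0\}$: $v(x)=\infty$ iff $x=0$; $v(x+y)\geq_0\min_0(v(x),v(y))$; $v(\lambda x)=v(x)$; if $0<_1x<_1y$ then $v(x)\geq_0v(y)$; $v(v(x))=v(x)$ (with $v(\infty)=\infty$); and $v(x)>_10$. A Hamel space is a pair $(G,v)$ with $G$ a $2$-ordered $C$-vector space and $v$ a Hamel valuation on it. For $X\subseteq G$, $v(X)$ denotes the image $\{v(x):x\in X\}$. -}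

module Defs where

open import Data.Nat using (ℕ; zero; suc; _≤_)
open import Data.Fin using (Fin; zero; suc)
open import Data.Maybe using (Maybe; just; nothing)
open import Data.Product using (Σ; _×_; _,_; ∃)
open import Data.Sum using (_⊎_)
open import Data.Empty using (⊥)
open import Data.Unit using (⊤)
open import Data.List using (List; length)
open import Data.List.Relation.Unary.All using (All)
open import Data.List.Relation.Unary.Unique.Propositional using (Unique)
open import Relation.Nullary using (¬_)
open import Relation.Binary using (Tri; tri<; tri≈; tri>)
open import Relation.Binary.Structures using (IsStrictTotalOrder)
open import Relation.Binary.PropositionalEquality using (_≡_)
open import Algebra.Structures using (IsCommutativeRing; IsAbelianGroup)

record OrderedField : Set₁ where
  infixl 6 _+_
  infixl 7 _*_
  infix 4 _<_
  field
    Carrier : Set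
    0# 1#   : Carrier
    _+_ _*_ : Carrier → Carrier → Carrier
    -_      : Carrier → Carrier
    _<_     : Carrier → Carrier → Set
    isCommutativeRing : IsCommutativeRing _≡_ _+_ _*_ -_ 0# 1#
    0≢1     : ¬ (0# ≡ 1#)
    inverse : ∀ x → ¬ (x ≡ 0#) → Σ Carrier (λ y → x * y ≡ 1#)
    isStrictTotalOrder : IsStrictTotalOrder _≡_ _<_
    +-mono-< : ∀ {x y} z → x < y → x + z < y + z
    *-pos    : ∀ {x y} → 0# < x → 0# < y → 0# < x * y

record TwoOrderedVectorSpace (F : OrderedField) : Set₁ where
  open OrderedField F using () renaming (Carrier to C; _+_ to _+C_; _*_ to _*C_;
    0# to 0C; 1# to 1C; _<_ to _<C_)
  infixl 6 _+_
  infixr 7 _·_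
  infix 4 _<₀_ _<₁_ _<₀∞_ _<₁∞_ _≤₀∞_
  field
    G   : Set
    0G  : G
    _+_ : G → G → G
    -_  : G → G
    _·_ : C → G → G
    isAbelianGroup : IsAbelianGroup _≡_ _+_ 0G -_
    ·-distribˡ : ∀ (a : C) x y → a · (x + y) ≡ a · x + a · y
    ·-distribʳ : ∀ (a b : C) x → (a +C b) · x ≡ a · x + b · x
    ·-assoc    : ∀ (a b : C) x → (a *C b) · x ≡ a · (b · x)
    ·-identity : ∀ x → 1C · x ≡ x
    _<₀_ _<₁_ : G → G → Set
    <₀-isStrictTotalOrder : IsStrictTotalOrder _≡_ _<₀_
    <₁-isStrictTotalOrder : IsStrictTotalOrder _≡_ _<₁_
    +-mono-<₀ : ∀ {x y} z → x <₀ y → x + z <₀ y + z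
    +-mono-<₁ : ∀ {x y} z → x <₁ y → x + z <₁ y + z
    ·-pos₀ : ∀ {a : C} {x} → 0C <C a → 0G <₀ x → 0G <₀ a · x
    ·-pos₁ : ∀ {a : C} {x} → 0C <C a → 0G <₁ x → 0G <₁ a · x

  -- G∞ = G ∪ {∞}, with ∞ (= nothing) above G in both orders
  G∞ : Set
  G∞ = Maybe G

  _<₀∞_ : G∞ → G∞ → Set
  just x  <₀∞ just y  = x <₀ y
  just x  <₀∞ nothing = ⊤
  nothing <₀∞ _       = ⊥

  _<₁∞_ : G∞ → G∞ → Set
  just x  <₁∞ just y  = x <₁ y
  just x  <₁∞ nothing = ⊤
  nothing <₁∞ _       = ⊥

  _≤₀∞_ : G∞ → G∞ → Set
  a ≤₀∞ b = a <₀∞ b ⊎ a ≡ b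

  min₀∞ : G∞ → G∞ → G∞
  min₀∞ nothing  b        = b
  min₀∞ (just x) nothing  = just x
  min₀∞ (just x) (just y) with IsStrictTotalOrder.compare <₀-isStrictTotalOrder x y
  ... | tri< _ _ _ = just x
  ... | tri≈ _ _ _ = just x
  ... | tri> _ _ _ = just y

extend∞ : {G : Set} → (G → Maybe G) → Maybe G → Maybe G
extend∞ v nothing  = nothing
extend∞ v (just x) = v x

record IsHamelValuation {F : OrderedField} (V : TwoOrderedVectorSpace F)
         (v : TwoOrderedVectorSpace.G V → TwoOrderedVectorSpace.G∞ V) : Set where
  open OrderedField F using () renaming (Carrier to C; 0# to 0C)
  open TwoOrderedVectorSpace V
  field
    v-∞    : ∀ x → (v x ≡ nothing → x ≡ 0G) × (x ≡ 0G → v x ≡ nothing)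
    v-ultra : ∀ x y → min₀∞ (v x) (v y) ≤₀∞ v (x + y)
    v-scal  : ∀ (a : C) x → ¬ (a ≡ 0C) → v (a · x) ≡ v x
    v-mono  : ∀ x y → 0G <₁ x → x <₁ y → v y ≤₀∞ v x
    v-idem  : ∀ x → extend∞ v (v x) ≡ v x
    v-pos   : ∀ x → just 0G <₁∞ v x

record HamelSpace (F : OrderedField) : Set₁ where
  field
    space : TwoOrderedVectorSpace F
  open TwoOrderedVectorSpace space public
  field
    v : G → G∞
    isHamelValuation : IsHamelValuation space v

module _ {F : OrderedField} (H : HamelSpace F) where
  open OrderedField F using () renaming (Carrier to C)
  open HamelSpace H

  record IsSubspace (G₀ : G → Set) : Set where
    field
      0∈  : G₀ 0G
      +∈  : ∀ {x y} → G₀ x → G₀ y → G₀ (x + y)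
      ·∈  : ∀ (a : C) {x} → G₀ x → G₀ (a · x)

  linComb : (m : ℕ) → (Fin m → C) → (Fin m → G) → G
  linComb zero    a c = 0G
  linComb (suc m) a c = a zero · c zero + linComb m (λ i → a (suc i)) (λ i → c (suc i))

  SumSpan : (G → Set) → (m : ℕ) → (Fin m → G) → G → Set
  SumSpan G₀ m c y = Σ G (λ g → G₀ g × Σ (Fin m → C) (λ a → y ≡ g + linComb m a c))

  vImage : (G → Set) → G∞ → Set
  vImage X z = Σ G (λ x → X x × v x ≡ z)

-- # S ≤ m : every list of pairwise distinct elements of S has length ≤ m
HasAtMost : {A : Set} → ℕ → (A → Set) → Set
HasAtMost {A} m S = (l : List A) → Unique l → All S l → length l ≤ m

module Submission where

-- Adjoin the cᵢ one at a time. The key fact is that G₀ + Cc has at most one valuation outside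
-- v(G₀): after rescaling, such a value is v(h + c) with h ∈ G₀, and if v(h + c) ≠ v(h′ + c),
-- the ultrametric inequality applied to h + c = (h − h′) + (h′ + c) puts v(h + c) in
-- {v(h − h′), v(h′ + c)}, both impossible. A new value of G₀ + Σ Ccᵢ is then new either for
-- G₀ + Cc₁ or, over G₀ + Cc₁, for (G₀ + Cc₁) + Σ_{i≥2} Ccᵢ. Telling which is only possible
-- classically, which is harmless because the conclusion length ≤ m is decidable.

open import Defs
open import Data.Nat using (ℕ; zero; suc; _≤_; _≤?_; z≤n; s≤s)
open import Data.Fin using (Fin)
import Data.Fin as Fin
open import Data.Product using (Σ; _×_; _,_; proj₁; proj₂)
open import Data.Sum using (_⊎_; inj₁; inj₂; map₂; [_,_]′)
open import Data.Empty using (⊥-elim)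
open import Data.Unit using (tt)
open import Data.Maybe using (just; nothing)
open import Data.List using ([]; _∷_; length)
open import Data.List.Relation.Unary.All as All using (All; []; _∷_)
open import Data.List.Relation.Unary.AllPairs using ([]; _∷_)
open import Function using (_∘_)
open import Relation.Nullary using (¬_; yes; no)
open import Relation.Nullary.Decidable using (decidable-stable; ¬¬-excluded-middle)
open import Relation.Nullary.Negation using (¬¬-Monad; ¬¬-map)
open import Relation.Binary using (tri<; tri≈; tri>)
open import Relation.Binary.Structures using (IsStrictTotalOrder)
open import Relation.Binary.PropositionalEquality
open import Algebra.Bundles using (AbelianGroup)
open import Algebra.Structures using (IsCommutativeRing; IsAbelianGroup)

module _ {A : Set} where
  open import Data.Nat using (_+_)
  open import Data.Nat.Properties using (+-suc; ≤-pred)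

  HasAtMost-empty : {S : A → Set} → (∀ {z} → ¬ S z) → HasAtMost 0 S
  HasAtMost-empty ∉S []      _ _        = z≤n
  HasAtMost-empty ∉S (_ ∷ _) _ (sx ∷ _) = ⊥-elim (∉S sx)

  HasAtMost-subsingleton : {S : A → Set} → (∀ {z z′} → S z → S z′ → z ≡ z′) → HasAtMost 1 S
  HasAtMost-subsingleton S-prop []          _               _             = z≤n
  HasAtMost-subsingleton S-prop (_ ∷ [])    _               _             = s≤s z≤n
  HasAtMost-subsingleton S-prop (_ ∷ _ ∷ _) ((x≢y ∷ _) ∷ _) (sx ∷ sy ∷ _) = ⊥-elim (x≢y (S-prop sx sy))

  HasAtMost-zero : {S : A → Set} → HasAtMost 0 S → ∀ {x} → ¬ S x
  HasAtMost-zero bound sx with bound (_ ∷ []) ([] ∷ []) (sx ∷ [])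
  ... | ()

  HasAtMost-remove : ∀ {m x} {S : A → Set} → HasAtMost (suc m) S → S x → HasAtMost m (λ z → S z × x ≢ z)
  HasAtMost-remove {x = x} bound sx l u sl =
    ≤-pred (bound (x ∷ l) (All.map proj₂ sl ∷ u) (sx ∷ All.map proj₁ sl))

  HasAtMost-∪ : ∀ {a b} {Q R : A → Set} → HasAtMost a Q → HasAtMost b R → HasAtMost (a + b) (λ z → Q z ⊎ R z)
  HasAtMost-∪ _ _ [] _ _ = z≤n
  HasAtMost-∪ {zero} Q≤ _ (_ ∷ _) _ (inj₁ qx ∷ _) = ⊥-elim (HasAtMost-zero Q≤ qx)
  HasAtMost-∪ {suc a} {Q = Q} {R} Q≤ R≤ (x ∷ xs) (x∉xs ∷ u) (inj₁ qx ∷ qrs) =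
    s≤s (HasAtMost-∪ (HasAtMost-remove Q≤ qx) R≤ xs u (All.zipWith separate (qrs , x∉xs)))
    where
    separate : ∀ {z} → (Q z ⊎ R z) × x ≢ z → (Q z × x ≢ z) ⊎ R z
    separate (inj₁ q , x≢z) = inj₁ (q , x≢z)
    separate (inj₂ r , _)   = inj₂ r
  HasAtMost-∪ {_} {zero} _ R≤ (_ ∷ _) _ (inj₂ rx ∷ _) = ⊥-elim (HasAtMost-zero R≤ rx)
  HasAtMost-∪ {a} {suc b} {Q} {R} Q≤ R≤ (x ∷ xs) (x∉xs ∷ u) (inj₂ rx ∷ qrs) =
    subst (suc (length xs) ≤_) (sym (+-suc a b))
      (s≤s (HasAtMost-∪ Q≤ (HasAtMost-remove R≤ rx) xs u (All.zipWith separate (qrs , x∉xs))))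
    where
    separate : ∀ {z} → (Q z ⊎ R z) × x ≢ z → Q z ⊎ (R z × x ≢ z)
    separate (inj₁ q , _)   = inj₁ q
    separate (inj₂ r , x≢z) = inj₂ (r , x≢z)

  HasAtMost-¬¬-mono : ∀ {m} {S T : A → Set} → (∀ {z} → S z → ¬ ¬ T z) → HasAtMost m T → HasAtMost m S
  HasAtMost-¬¬-mono {m} S⇒¬¬T bound l u sl =
    decidable-stable (length l ≤? m) (¬¬-map (bound l u) (All.sequenceM _ ¬¬-Monad (All.map S⇒¬¬T sl)))

module _ {F : OrderedField} (H : HamelSpace F) where
  open OrderedField F using (0≢1; inverse; isCommutativeRing; isStrictTotalOrder)
    renaming (Carrier to C; 0# to 0C; 1# to 1C; _*_ to _*C_; -_ to -C_; _+_ to _+C_)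
  open HamelSpace H
  open IsHamelValuation isHamelValuation using (v-ultra; v-scal)
  open IsAbelianGroup isAbelianGroup using (assoc; comm; identityʳ)
  open ≡-Reasoning
  private
    module CR = IsCommutativeRing isCommutativeRing
    module <₀ = IsStrictTotalOrder <₀-isStrictTotalOrder

  +-abelianGroup : AbelianGroup _ _
  +-abelianGroup = record { isAbelianGroup = isAbelianGroup }

  open import Algebra.Properties.AbelianGroup +-abelianGroup
    using (identityˡ-unique; inverseˡ-unique; //-rightDividesˡ; //-rightDividesʳ)
  open import Algebra.Properties.CommutativeSemigroup (AbelianGroup.commutativeSemigroup +-abelianGroup)
    using (interchange)

  0·x≡0 : ∀ x → 0C · x ≡ 0G
  0·x≡0 x = identityˡ-unique (0C · x) (0C · x) (begin
    0C · x + 0C · x   ≡⟨ ·-distribʳ 0C 0C x ⟨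
    (0C +C 0C) · x    ≡⟨ cong (_· x) (CR.+-identityʳ 0C) ⟩
    0C · x            ∎)

  -1·x≡-x : ∀ x → (-C 1C) · x ≡ - x
  -1·x≡-x x = inverseˡ-unique ((-C 1C) · x) x (begin
    (-C 1C) · x + x         ≡⟨ cong ((-C 1C) · x +_) (·-identity x) ⟨
    (-C 1C) · x + 1C · x    ≡⟨ ·-distribʳ (-C 1C) 1C x ⟨
    ((-C 1C) +C 1C) · x     ≡⟨ cong (_· x) (CR.-‿inverseˡ 1C) ⟩
    0C · x                  ≡⟨ 0·x≡0 x ⟩
    0G                      ∎)

  -1≢0 : -C 1C ≢ 0C
  -1≢0 -1≡0 = 0≢1 (begin
    0C               ≡⟨ CR.-‿inverseʳ 1C ⟨
    1C +C (-C 1C)    ≡⟨ cong (1C +C_) -1≡0 ⟩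
    1C +C 0C         ≡⟨ CR.+-identityʳ 1C ⟩
    1C               ∎)

  v-neg : ∀ x → v (- x) ≡ v x
  v-neg x = trans (cong v (sym (-1·x≡-x x))) (v-scal (-C 1C) x -1≢0)

  -‿closed : ∀ {G₀} → IsSubspace H G₀ → ∀ {x} → G₀ x → G₀ (- x)
  -‿closed {G₀} G₀-sub x∈ = subst G₀ (-1·x≡-x _) (IsSubspace.·∈ G₀-sub (-C 1C) x∈)

  <₀∞-trans : ∀ {a b c} → a <₀∞ b → b <₀∞ c → a <₀∞ c
  <₀∞-trans {just _}  {just _}  {just _}  a<b b<c = <₀.trans a<b b<c
  <₀∞-trans {just _}  {just _}  {nothing} _   _   = tt
  <₀∞-trans {just _}  {nothing} {_}       _   ()
  <₀∞-trans {nothing} {_}       {_}       ()  _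

  <₀∞-irrefl : ∀ {a} → ¬ a <₀∞ a
  <₀∞-irrefl {just x}  = <₀.irrefl {x} {x} refl
  <₀∞-irrefl {nothing} ()

  ≤₀∞-trans : ∀ {a b c} → a ≤₀∞ b → b ≤₀∞ c → a ≤₀∞ c
  ≤₀∞-trans {a} {b} {c} (inj₁ a<b) (inj₁ b<c) = inj₁ (<₀∞-trans {a} {b} {c} a<b b<c)
  ≤₀∞-trans (inj₁ a<b) (inj₂ refl) = inj₁ a<b
  ≤₀∞-trans (inj₂ refl) b≤c       = b≤c

  <₀∞⇒≱ : ∀ {a b} → a <₀∞ b → ¬ b ≤₀∞ a
  <₀∞⇒≱ {a} {b} a<b (inj₁ b<a) = <₀∞-irrefl {a} (<₀∞-trans {a} {b} {a} a<b b<a)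
  <₀∞⇒≱ {a} a<b (inj₂ refl)     = <₀∞-irrefl {a} a<b

  ≤₀∞-antisym : ∀ {a b} → a ≤₀∞ b → b ≤₀∞ a → a ≡ b
  ≤₀∞-antisym (inj₁ a<b) b≤a = ⊥-elim (<₀∞⇒≱ a<b b≤a)
  ≤₀∞-antisym (inj₂ a≡b) _   = a≡b

  <₀∞-connex : ∀ {a b} → a ≢ b → a <₀∞ b ⊎ b <₀∞ a
  <₀∞-connex {just x}  {just y}  x≢y with <₀.compare x y
  ... | tri< x<y _ _ = inj₁ x<y
  ... | tri≈ _ x≡y _ = ⊥-elim (x≢y (cong just x≡y))
  ... | tri> _ _ y<x = inj₂ y<x
  <₀∞-connex {just _}  {nothing} _   = inj₁ tt
  <₀∞-connex {nothing} {just _}  _   = inj₂ tt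
  <₀∞-connex {nothing} {nothing} ∞≢∞ = ⊥-elim (∞≢∞ refl)

  min₀∞-≤-split : ∀ a b {c} → min₀∞ a b ≤₀∞ c → a ≤₀∞ c ⊎ b ≤₀∞ c
  min₀∞-≤-split nothing  b        min≤c = inj₂ min≤c
  min₀∞-≤-split (just _) nothing  min≤c = inj₁ min≤c
  min₀∞-≤-split (just x) (just y) min≤c with <₀.compare x y
  ... | tri< _ _ _ = inj₁ min≤c
  ... | tri≈ _ _ _ = inj₁ min≤c
  ... | tri> _ _ _ = inj₂ min≤c

  v-ultra-split : ∀ x y → v x ≤₀∞ v (x + y) ⊎ v y ≤₀∞ v (x + y)
  v-ultra-split x y = min₀∞-≤-split (v x) (v y) (v-ultra x y)

  v-ultra-split-cancel : ∀ x y → v (x + y) ≤₀∞ v x ⊎ v y ≤₀∞ v x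
  v-ultra-split-cancel x y =
    subst (λ t → v (x + y) ≤₀∞ v t ⊎ v y ≤₀∞ v t) (//-rightDividesʳ y x)
      (map₂ (subst (_≤₀∞ v ((x + y) + - y)) (v-neg y)) (v-ultra-split (x + y) (- y)))

  v-+-of-< : ∀ {x y} → v x <₀∞ v y → v (x + y) ≡ v x
  v-+-of-< {x} {y} vx<vy with v-ultra-split x y | v-ultra-split-cancel x y
  ... | _          | inj₂ vy≤vx = ⊥-elim (<₀∞⇒≱ vx<vy vy≤vx)
  ... | inj₁ vx≤vs | inj₁ vs≤vx = ≤₀∞-antisym vs≤vx vx≤vs
  ... | inj₂ vy≤vs | inj₁ vs≤vx = ⊥-elim (<₀∞⇒≱ vx<vy (≤₀∞-trans {v y} vy≤vs vs≤vx))

  v-+-of-≢ : ∀ {x y} → v x ≢ v y → v (x + y) ≡ v x ⊎ v (x + y) ≡ v y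
  v-+-of-≢ {x} {y} vx≢vy with <₀∞-connex vx≢vy
  ... | inj₁ vx<vy = inj₁ (v-+-of-< vx<vy)
  ... | inj₂ vy<vx = inj₂ (trans (cong v (comm x y)) (v-+-of-< vy<vx))

  Adjoin : (G → Set) → G → G → Set
  Adjoin G₀ c y = Σ G λ g → G₀ g × Σ C λ a → y ≡ g + a · c

  Adjoin-isSubspace : ∀ {G₀} → IsSubspace H G₀ → ∀ c → IsSubspace H (Adjoin G₀ c)
  Adjoin-isSubspace G₀-sub c = record
    { 0∈ = 0G , 0∈ , 0C , sym (trans (cong (0G +_) (0·x≡0 c)) (identityʳ 0G))
    ; +∈ = λ { (g , g∈ , a , refl) (g′ , g′∈ , a′ , refl) →
        g + g′ , +∈ g∈ g′∈ , a +C a′ ,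
        trans (interchange g (a · c) g′ (a′ · c)) (cong ((g + g′) +_) (sym (·-distribʳ a a′ c))) }
    ; ·∈ = λ { b (g , g∈ , a , refl) →
        b · g , ·∈ b g∈ , b *C a ,
        trans (·-distribˡ b g (a · c)) (cong (b · g +_) (sym (·-assoc b a c))) }
    }
    where open IsSubspace G₀-sub

  SumSpan-zero : ∀ {G₀} c {y} → SumSpan H G₀ 0 c y → G₀ y
  SumSpan-zero {G₀} _ (g , g∈ , _ , refl) = subst G₀ (sym (identityʳ g)) g∈

  SumSpan-suc : ∀ {G₀ m} c {y} → SumSpan H G₀ (suc m) c y → SumSpan H (Adjoin G₀ (c Fin.zero)) m (c ∘ Fin.suc) y
  SumSpan-suc _ (g , g∈ , a , refl) = _ , (g , g∈ , a Fin.zero , refl) , a ∘ Fin.suc , sym (assoc g _ _)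

  NewValue : (G → Set) → (G → Set) → G∞ → Set
  NewValue G₀ X z = vImage H X z × ¬ vImage H G₀ z

  right-inverse-≢0 : ∀ {a b} → a *C b ≡ 1C → b ≢ 0C
  right-inverse-≢0 {a} ab≡1 refl = 0≢1 (trans (sym (CR.zeroʳ a)) ab≡1)

  ·-+-cancel : ∀ {a b} g c → a *C b ≡ 1C → b · (g + a · c) ≡ b · g + c
  ·-+-cancel {a} {b} g c ab≡1 = begin
    b · (g + a · c)       ≡⟨ ·-distribˡ b g (a · c) ⟩
    b · g + b · (a · c)   ≡⟨ cong (b · g +_) (·-assoc b a c) ⟨
    b · g + (b *C a) · c  ≡⟨ cong (λ t → b · g + t · c) (trans (CR.*-comm b a) ab≡1) ⟩
    b · g + 1C · c        ≡⟨ cong (b · g +_) (·-identity c) ⟩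
    b · g + c             ∎

  newValue-Adjoin-translate : ∀ {G₀ c z} → IsSubspace H G₀ → NewValue G₀ (Adjoin G₀ c) z
                            → Σ G λ h → G₀ h × v (h + c) ≡ z
  newValue-Adjoin-translate {G₀} {c} {z} G₀-sub ((_ , (g , g∈ , a , refl) , vy≡z) , new)
    with IsStrictTotalOrder._≟_ isStrictTotalOrder a 0C
  ... | yes refl = ⊥-elim (new (g , g∈ , trans (cong v g≡g+0c) vy≡z))
    where
    g≡g+0c : g ≡ g + 0C · c
    g≡g+0c = sym (trans (cong (g +_) (0·x≡0 c)) (identityʳ g))
  ... | no a≢0 with inverse a a≢0
  ... | b , ab≡1 = b · g , IsSubspace.·∈ G₀-sub b g∈ , (begin
    v (b · g + c)          ≡⟨ cong v (·-+-cancel g c ab≡1) ⟨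
    v (b · (g + a · c))    ≡⟨ v-scal b _ (right-inverse-≢0 ab≡1) ⟩
    v (g + a · c)          ≡⟨ vy≡z ⟩
    z                      ∎)

  v-translate-unique : ∀ {G₀ c h h′} → IsSubspace H G₀ → G₀ h → G₀ h′
                     → ¬ vImage H G₀ (v (h + c)) → ¬ vImage H G₀ (v (h′ + c))
                     → v (h + c) ≡ v (h′ + c)
  v-translate-unique {G₀} {c} {h} {h′} G₀-sub h∈ h′∈ new new′ =
    [ (λ vhc≡vd → ⊥-elim (new (_ , d∈ , sym (trans (cong v (sym d+h′c≡hc)) vhc≡vd))))
    , trans (cong v (sym d+h′c≡hc))
    ]′ (v-+-of-≢ (λ vd≡vh′c → new′ (_ , d∈ , vd≡vh′c)))
    where
    d∈ : G₀ (h + - h′)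
    d∈ = IsSubspace.+∈ G₀-sub h∈ (-‿closed G₀-sub h′∈)
    d+h′c≡hc : (h + - h′) + (h′ + c) ≡ h + c
    d+h′c≡hc = trans (sym (assoc (h + - h′) h′ c)) (cong (_+ c) (//-rightDividesˡ h′ h))

  newValue-Adjoin-unique : ∀ {G₀} c {z z′} → IsSubspace H G₀
                         → NewValue G₀ (Adjoin G₀ c) z → NewValue G₀ (Adjoin G₀ c) z′ → z ≡ z′
  newValue-Adjoin-unique c G₀-sub new new′
    with newValue-Adjoin-translate G₀-sub new | newValue-Adjoin-translate G₀-sub new′
  ... | h , h∈ , refl | h′ , h′∈ , refl = v-translate-unique G₀-sub h∈ h′∈ (proj₂ new) (proj₂ new′)

  newValue-split : ∀ {G₀ m} c {z} → NewValue G₀ (SumSpan H G₀ (suc m) c) z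
                 → ¬ ¬ (NewValue G₀ (Adjoin G₀ (c Fin.zero)) z
                       ⊎ NewValue (Adjoin G₀ (c Fin.zero)) (SumSpan H (Adjoin G₀ (c Fin.zero)) m (c ∘ Fin.suc)) z)
  newValue-split c ((y , y∈ , vy≡z) , new) = ¬¬-map
    (λ { (yes old₁) → inj₁ (old₁ , new)
       ; (no new₁)  → inj₂ ((y , SumSpan-suc c y∈ , vy≡z) , new₁) })
    ¬¬-excluded-middle

  newValues-bound : ∀ m {G₀} → IsSubspace H G₀ → (c : Fin m → G) → HasAtMost m (NewValue G₀ (SumSpan H G₀ m c))
  newValues-bound zero    G₀-sub c = HasAtMost-empty λ { ((_ , y∈ , refl) , new) → new (_ , SumSpan-zero c y∈ , refl) }
  newValues-bound (suc m) G₀-sub c = HasAtMost-¬¬-mono (newValue-split c)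
    (HasAtMost-∪ (HasAtMost-subsingleton (newValue-Adjoin-unique (c Fin.zero) G₀-sub))
                 (newValues-bound m (Adjoin-isSubspace G₀-sub (c Fin.zero)) (c ∘ Fin.suc)))

proposition4p4 : (F : OrderedField) (H : HamelSpace F)
    (G₀ : HamelSpace.G H → Set) → IsSubspace H G₀
    → (m : ℕ) (c : Fin m → HamelSpace.G H) → (∀ i → ¬ G₀ (c i))
    → HasAtMost m (λ z → vImage H (SumSpan H G₀ m c) z × ¬ vImage H G₀ z)
proposition4p4 F H G₀ G₀-sub m c _ = newValues-bound H m G₀-sub c
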